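{- Let $k,\ell$ be positive integers. Then $$ \left[\begin{matrix} k+\ell \\ k\end{matrix}\right]_q = 1 + \sum_{i=1}^k \sum_{j=0}^{k-i} q^i \left[\begin{matrix} \ell \\ i\end{matrix}\right]_q \cdot q^{j(\ell-i+1)} \left[\begin{matrix} i+j-1 \\ j\end{matrix}\right]_q $$ as polynomials in $q$.
   Context: For integers $a \ge 0$ and $b$, $\left[\begin{matrix} a \\ b\end{matrix}\right]_q$ denotes the Gaussian ($q$-)binomial coefficient: for $0\le b\le a$ it equals $\frac{(1-q)(1-q^2)\cdots(1-q^{a})}{(1-q)\cdots(1-q^{b})\cdot(1-q)\cdots(1-q^{a-b})}$, and it is $0$ if $b>a$ or $b<0$. -}

module Defs where

open import Data.Nat as ℕ using (ℕ; zero; suc; _∸_; _≤?_)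
open import Data.Nat.Divisibility using (_∣?_)
open import Data.Integer using (ℤ; 0ℤ; 1ℤ; _+_; _*_; _-_)
open import Relation.Nullary.Decidable using (does)
open import Data.Bool using (if_then_else_)

-- Formal power series in q with integer coefficients (coefficient functions).
-- Polynomials embed faithfully, so "equality as polynomials" is coefficientwise equality.
Series : Set
Series = ℕ → ℤ

sumℕ : ℕ → (ℕ → ℤ) → ℤ
sumℕ zero    f = 0ℤ
sumℕ (suc n) f = sumℕ n f + f n

zeroS : Series
zeroS _ = 0ℤ

oneS : Series
oneS zero    = 1ℤ
oneS (suc _) = 0ℤ

X^ : ℕ → Series
X^ m n = if does (m ℕ.≟ n) then 1ℤ else 0ℤ

_⊕_ : Series → Series → Series
(f ⊕ g) n = f n + g n

_⊖_ : Series → Series → Series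
(f ⊖ g) n = f n - g n

_⊗_ : Series → Series → Series
(f ⊗ g) n = sumℕ (suc n) (λ j → f j * g (n ∸ j))

infixl 6 _⊕_ _⊖_
infixl 7 _⊗_

prod₁ : ℕ → (ℕ → Series) → Series
prod₁ zero    F = oneS
prod₁ (suc a) F = prod₁ a F ⊗ F (suc a)

sum₁ : ℕ → (ℕ → Series) → Series
sum₁ zero    F = zeroS
sum₁ (suc a) F = sum₁ a F ⊕ F (suc a)

sum₀ : ℕ → (ℕ → Series) → Series
sum₀ zero    F = zeroS
sum₀ (suc a) F = sum₀ a F ⊕ F a

oneMinusX^ : ℕ → Series
oneMinusX^ i = oneS ⊖ X^ i

-- the power series 1/(1 - q^(suc m)) = Σ_k q^((suc m) k)
invOneMinusX^suc : ℕ → Series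
invOneMinusX^suc m n = if does (suc m ∣? n) then 1ℤ else 0ℤ

invQFact : ℕ → Series
invQFact zero    = oneS
invQFact (suc a) = invQFact a ⊗ invOneMinusX^suc a

qbinom : ℕ → ℕ → Series
qbinom a b = if does (b ≤? a)
             then prod₁ a oneMinusX^ ⊗ invQFact b ⊗ invQFact (a ∸ b)
             else zeroS

{-# OPTIONS --safe #-}
module Submission where

-- Let qbin be the Gaussian binomial given by the q-Pascal recurrence
-- [a+1, b+1] = [a, b] + q^(b+1) [a, b+1].  It satisfies [b+c, b] [b]! [c]! = [b+c]!, and every
-- factor 1 - q^i of a q-factorial is invertible as a power series, so qbin agrees with the quotient
-- definition.  Unrolling the recurrence along the diagonal gives
--   [k+ℓ, k] = 1 + Σ_{t=1..k} q^t [ℓ+t-1, t].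
-- The q-Vandermonde identity [n+m, K] = Σ_i [n, i] [m, K-i] q^((K-i)(n-i)), taken with n = ℓ,
-- m = t-1 and K = t, turns q^t [ℓ+t-1, t] into Σ_{i=1..t} q^i [ℓ, i] q^((t-i)(ℓ-i+1)) [t-1, t-i]
-- (the term i = 0 vanishes as [t-1, t] = 0).  Substituting j = t - i and exchanging the two sums
-- gives the right-hand side.

open import Defs
open import Data.Nat using (ℕ; zero; suc; _+_; _*_; _∸_; _≤_; _<_; _≥_; s≤s; z≤n; _≟_; _≤?_; _<?_)
open import Data.Nat.Divisibility using (_∣_; _∣?_; ∣-refl; _∣0; ∣m+n∣m⇒∣n; ∣m∣n⇒∣m+n; >⇒∤)
import Data.Nat.Properties as ℕₚ
open import Data.Integer as ℤ using (ℤ; 0ℤ; 1ℤ)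
import Data.Integer.Properties as ℤₚ
open import Algebra.Properties.CommutativeSemigroup ℤₚ.+-commutativeSemigroup using (interchange)
open import Algebra.Bundles using (CommutativeRing)
open import Algebra.Solver.Ring.AlmostCommutativeRing using (fromCommutativeRing; _-Raw-AlmostCommutative⟶_)
import Algebra.Solver.Ring
open import Data.Bool using (if_then_else_)
open import Data.Maybe using (Maybe; just; nothing)
open import Data.Product using (_,_)
open import Function using (_∘_)
open import Level using (0ℓ)
open import Relation.Binary.Structures using (IsEquivalence)
import Relation.Binary.Reasoning.Setoid as SetoidReasoning
open import Relation.Nullary.Decidable using (Dec; does; yes; no; dec-true; dec-false)
open import Relation.Nullary.Negation using (contradiction)
open import Relation.Binary.PropositionalEquality

sumℕ-cong : ∀ N {f g : ℕ → ℤ} → (∀ j → j < N → f j ≡ g j) → sumℕ N f ≡ sumℕ N g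
sumℕ-cong zero    f≡g = refl
sumℕ-cong (suc N) f≡g =
  cong₂ ℤ._+_ (sumℕ-cong N (λ j j<N → f≡g j (ℕₚ.m<n⇒m<1+n j<N))) (f≡g N ℕₚ.≤-refl)

sumℕ-zero : ∀ N {f : ℕ → ℤ} → (∀ j → j < N → f j ≡ 0ℤ) → sumℕ N f ≡ 0ℤ
sumℕ-zero zero    f≡0 = refl
sumℕ-zero (suc N) f≡0 =
  cong₂ ℤ._+_ (sumℕ-zero N (λ j j<N → f≡0 j (ℕₚ.m<n⇒m<1+n j<N))) (f≡0 N ℕₚ.≤-refl)

sumℕ-+ : ∀ N (f g : ℕ → ℤ) → sumℕ N (λ j → f j ℤ.+ g j) ≡ sumℕ N f ℤ.+ sumℕ N g
sumℕ-+ zero    f g = refl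
sumℕ-+ (suc N) f g = trans (cong (ℤ._+ (f N ℤ.+ g N)) (sumℕ-+ N f g))
                           (interchange (sumℕ N f) (sumℕ N g) (f N) (g N))

sumℕ-*ˡ : ∀ N c (f : ℕ → ℤ) → c ℤ.* sumℕ N f ≡ sumℕ N (λ j → c ℤ.* f j)
sumℕ-*ˡ zero    c f = ℤₚ.*-zeroʳ c
sumℕ-*ˡ (suc N) c f =
  trans (ℤₚ.*-distribˡ-+ c (sumℕ N f) (f N)) (cong (ℤ._+ (c ℤ.* f N)) (sumℕ-*ˡ N c f))

sumℕ-head : ∀ N (f : ℕ → ℤ) → sumℕ (suc N) f ≡ f 0 ℤ.+ sumℕ N (f ∘ suc)
sumℕ-head zero    f = trans (ℤₚ.+-identityˡ (f 0)) (sym (ℤₚ.+-identityʳ (f 0)))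
sumℕ-head (suc N) f = trans (cong (ℤ._+ f (suc N)) (sumℕ-head N f)) (ℤₚ.+-assoc (f 0) _ _)

sumℕ-reverse : ∀ n (f : ℕ → ℤ) → sumℕ (suc n) f ≡ sumℕ (suc n) (λ j → f (n ∸ j))
sumℕ-reverse zero    f = refl
sumℕ-reverse (suc n) f = begin
  sumℕ (suc n) f ℤ.+ f (suc n)                      ≡⟨ cong (ℤ._+ f (suc n)) (sumℕ-reverse n f) ⟩
  sumℕ (suc n) (λ j → f (n ∸ j)) ℤ.+ f (suc n)      ≡⟨ ℤₚ.+-comm _ (f (suc n)) ⟩
  f (suc n) ℤ.+ sumℕ (suc n) (λ j → f (n ∸ j))      ≡⟨ sumℕ-head (suc n) (λ j → f (suc n ∸ j)) ⟨
  sumℕ (suc (suc n)) (λ j → f (suc n ∸ j))          ∎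
  where open ≡-Reasoning

sumℕ-antidiagonal : ∀ n (F : ℕ → ℕ → ℤ) →
  sumℕ (suc n) (λ j → sumℕ (suc j) (λ i → F i (j ∸ i))) ≡ sumℕ (suc n) (λ i → sumℕ (suc (n ∸ i)) (F i))
sumℕ-antidiagonal zero    F = refl
sumℕ-antidiagonal (suc n) F = begin
  sumℕ (suc (suc n)) (λ j → sumℕ (suc j) (λ i → F i (j ∸ i)))
    ≡⟨ sumℕ-cong (suc (suc n)) (λ j _ → peel j) ⟩
  sumℕ (suc (suc n)) (λ j → F 0 j ℤ.+ rest j)
    ≡⟨ sumℕ-+ (suc (suc n)) (F 0) rest ⟩
  sumℕ (suc (suc n)) (F 0) ℤ.+ sumℕ (suc (suc n)) rest
    ≡⟨ cong (ℤ._+_ (sumℕ (suc (suc n)) (F 0))) (trans (sumℕ-head (suc n) rest) (ℤₚ.+-identityˡ _)) ⟩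
  sumℕ (suc (suc n)) (F 0) ℤ.+ sumℕ (suc n) (λ j → sumℕ (suc j) (λ i → F (suc i) (j ∸ i)))
    ≡⟨ cong (ℤ._+_ (sumℕ (suc (suc n)) (F 0))) (sumℕ-antidiagonal n (F ∘ suc)) ⟩
  sumℕ (suc (suc n)) (F 0) ℤ.+ sumℕ (suc n) (λ i → sumℕ (suc (n ∸ i)) (F (suc i)))
    ≡⟨ sumℕ-head (suc n) (λ i → sumℕ (suc (suc n ∸ i)) (F i)) ⟨
  sumℕ (suc (suc n)) (λ i → sumℕ (suc (suc n ∸ i)) (F i)) ∎
  where
  open ≡-Reasoning
  rest : ℕ → ℤ
  rest zero    = 0ℤ
  rest (suc j) = sumℕ (suc j) (λ i → F (suc i) (j ∸ i))
  peel : ∀ j → sumℕ (suc j) (λ i → F i (j ∸ i)) ≡ F 0 j ℤ.+ rest j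
  peel zero    = trans (ℤₚ.+-identityˡ (F 0 0)) (sym (ℤₚ.+-identityʳ (F 0 0)))
  peel (suc j) = sumℕ-head (suc j) (λ i → F i (suc j ∸ i))

-- The ring of power series

infix 4 _≈_
_≈_ : Series → Series → Set
f ≈ g = ∀ n → f n ≡ g n

≈-refl : ∀ {f} → f ≈ f
≈-refl n = refl

≈-sym : ∀ {f g} → f ≈ g → g ≈ f
≈-sym f≈g n = sym (f≈g n)

≈-trans : ∀ {f g h} → f ≈ g → g ≈ h → f ≈ h
≈-trans f≈g g≈h n = trans (f≈g n) (g≈h n)

≈-isEquivalence : IsEquivalence _≈_
≈-isEquivalence = record { refl = ≈-refl ; sym = ≈-sym ; trans = ≈-trans }

≡⇒≈ : ∀ {f g} → f ≡ g → f ≈ g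
≡⇒≈ refl = ≈-refl

negS : Series → Series
negS f n = ℤ.- f n

⊕-cong : ∀ {f f′ g g′} → f ≈ f′ → g ≈ g′ → f ⊕ g ≈ f′ ⊕ g′
⊕-cong f≈f′ g≈g′ n = cong₂ ℤ._+_ (f≈f′ n) (g≈g′ n)

⊗-cong : ∀ {f f′ g g′} → f ≈ f′ → g ≈ g′ → f ⊗ g ≈ f′ ⊗ g′
⊗-cong f≈f′ g≈g′ n = sumℕ-cong (suc n) (λ j _ → cong₂ ℤ._*_ (f≈f′ j) (g≈g′ (n ∸ j)))

⊗-comm : ∀ f g → f ⊗ g ≈ g ⊗ f
⊗-comm f g n = trans (sumℕ-reverse n _) (sumℕ-cong (suc n) swap)
  where
  swap : ∀ j → j < suc n → f (n ∸ j) ℤ.* g (n ∸ (n ∸ j)) ≡ g j ℤ.* f (n ∸ j)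
  swap j j<1+n = trans (ℤₚ.*-comm (f (n ∸ j)) _)
                       (cong (λ i → g i ℤ.* f (n ∸ j)) (ℕₚ.m∸[m∸n]≡n (ℕₚ.≤-pred j<1+n)))

⊗-assoc : ∀ f g h → (f ⊗ g) ⊗ h ≈ f ⊗ (g ⊗ h)
⊗-assoc f g h n = begin
  sumℕ (suc n) (λ j → sumℕ (suc j) (λ i → f i ℤ.* g (j ∸ i)) ℤ.* h (n ∸ j))
    ≡⟨ sumℕ-cong (suc n) (λ j _ → distribute j) ⟩
  sumℕ (suc n) (λ j → sumℕ (suc j) (λ i → F i (j ∸ i)))
    ≡⟨ sumℕ-antidiagonal n F ⟩
  sumℕ (suc n) (λ i → sumℕ (suc (n ∸ i)) (F i))
    ≡⟨ sumℕ-cong (suc n) (λ i _ → collect i) ⟩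
  sumℕ (suc n) (λ i → f i ℤ.* sumℕ (suc (n ∸ i)) (λ t → g t ℤ.* h (n ∸ i ∸ t))) ∎
  where
  open ≡-Reasoning
  F : ℕ → ℕ → ℤ
  F i t = f i ℤ.* g t ℤ.* h (n ∸ (i + t))
  distribute : ∀ j →
    sumℕ (suc j) (λ i → f i ℤ.* g (j ∸ i)) ℤ.* h (n ∸ j) ≡ sumℕ (suc j) (λ i → F i (j ∸ i))
  distribute j = trans (ℤₚ.*-comm _ (h (n ∸ j))) (trans (sumℕ-*ˡ (suc j) (h (n ∸ j)) _)
    (sumℕ-cong (suc j) (λ i i<1+j → trans (ℤₚ.*-comm (h (n ∸ j)) _)
      (cong (λ m → f i ℤ.* g (j ∸ i) ℤ.* h (n ∸ m)) (sym (ℕₚ.m+[n∸m]≡n (ℕₚ.≤-pred i<1+j)))))))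
  collect : ∀ i → sumℕ (suc (n ∸ i)) (F i) ≡ f i ℤ.* sumℕ (suc (n ∸ i)) (λ t → g t ℤ.* h (n ∸ i ∸ t))
  collect i = trans (sumℕ-cong (suc (n ∸ i)) (λ t _ → trans (ℤₚ.*-assoc (f i) (g t) _)
                      (cong (λ m → f i ℤ.* (g t ℤ.* h m)) (sym (ℕₚ.∸-+-assoc n i t)))))
                    (sym (sumℕ-*ˡ (suc (n ∸ i)) (f i) _))

⊗-identityˡ : ∀ f → oneS ⊗ f ≈ f
⊗-identityˡ f n = begin
  sumℕ (suc n) (λ j → oneS j ℤ.* f (n ∸ j))
    ≡⟨ sumℕ-head n _ ⟩
  1ℤ ℤ.* f n ℤ.+ sumℕ n (λ j → 0ℤ ℤ.* f (n ∸ suc j))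
    ≡⟨ cong₂ ℤ._+_ (ℤₚ.*-identityˡ (f n)) (sumℕ-zero n (λ _ _ → refl)) ⟩
  f n ℤ.+ 0ℤ
    ≡⟨ ℤₚ.+-identityʳ (f n) ⟩
  f n ∎
  where open ≡-Reasoning

⊗-distribˡ-⊕ : ∀ f g h → f ⊗ (g ⊕ h) ≈ f ⊗ g ⊕ f ⊗ h
⊗-distribˡ-⊕ f g h n =
  trans (sumℕ-cong (suc n) (λ j _ → ℤₚ.*-distribˡ-+ (f j) (g (n ∸ j)) (h (n ∸ j)))) (sumℕ-+ (suc n) _ _)

⊕-⊗-commutativeRing : CommutativeRing 0ℓ 0ℓ
⊕-⊗-commutativeRing = record
  { Carrier = Series ; _≈_ = _≈_ ; _+_ = _⊕_ ; _*_ = _⊗_ ; -_ = negS ; 0# = zeroS ; 1# = oneS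
  ; isCommutativeRing = record
    { isRing = record
      { +-isAbelianGroup = record
        { isGroup = record
          { isMonoid = record
            { isSemigroup = record
              { isMagma = record { isEquivalence = ≈-isEquivalence ; ∙-cong = ⊕-cong }
              ; assoc = λ f g h n → ℤₚ.+-assoc (f n) (g n) (h n) }
            ; identity = (λ f n → ℤₚ.+-identityˡ (f n)) , (λ f n → ℤₚ.+-identityʳ (f n)) }
          ; inverse = (λ f n → ℤₚ.+-inverseˡ (f n)) , (λ f n → ℤₚ.+-inverseʳ (f n))
          ; ⁻¹-cong = λ f≈g n → cong ℤ.-_ (f≈g n) }
        ; comm = λ f g n → ℤₚ.+-comm (f n) (g n) }
      ; *-cong = ⊗-cong
      ; *-assoc = ⊗-assoc
      ; *-identity = ⊗-identityˡ , (λ f → ≈-trans (⊗-comm f oneS) (⊗-identityˡ f))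
      ; distrib = ⊗-distribˡ-⊕ , λ f g h → ≈-trans (⊗-comm (g ⊕ h) f)
          (≈-trans (⊗-distribˡ-⊕ f g h) (⊕-cong (⊗-comm f g) (⊗-comm f h))) }
    ; *-comm = ⊗-comm } }

constS : ℤ → Series
constS c zero    = c
constS c (suc _) = 0ℤ

constS-homomorphism :
  CommutativeRing.rawRing ℤₚ.+-*-commutativeRing -Raw-AlmostCommutative⟶ fromCommutativeRing ⊕-⊗-commutativeRing
constS-homomorphism = record
  { ⟦_⟧    = constS
  ; +-homo = λ { a b zero → refl ; a b (suc n) → refl }
  ; *-homo = *-homo
  ; -‿homo = λ { a zero → refl ; a (suc n) → refl }
  ; 0-homo = λ { zero → refl ; (suc n) → refl }
  ; 1-homo = λ { zero → refl ; (suc n) → refl } }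
  where
  *-homo : ∀ a b → constS (a ℤ.* b) ≈ constS a ⊗ constS b
  *-homo a b zero    = sym (ℤₚ.+-identityˡ (a ℤ.* b))
  *-homo a b (suc n) = sym (sumℕ-zero (suc (suc n)) λ { zero _ → ℤₚ.*-zeroʳ a ; (suc j) _ → refl })

constS-≟ : ∀ a b → Maybe (constS a ≈ constS b)
constS-≟ a b with a ℤₚ.≟ b
... | yes refl = just ≈-refl
... | no _     = nothing

open Algebra.Solver.Ring _ _ constS-homomorphism constS-≟ using (solve; _:=_; _:+_; _:*_; _:-_; con)

-- The solver reads an integer constant c as constS c, which equals zeroS or oneS only coefficientwise.
𝟘 𝟙 : Series
𝟘 = constS 0ℤ
𝟙 = constS 1ℤ

zeroS≈𝟘 : zeroS ≈ 𝟘
zeroS≈𝟘 zero    = refl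
zeroS≈𝟘 (suc n) = refl

oneS≈𝟙 : oneS ≈ 𝟙
oneS≈𝟙 zero    = refl
oneS≈𝟙 (suc n) = refl

open SetoidReasoning (CommutativeRing.setoid ⊕-⊗-commutativeRing)

sum₀-cong : ∀ K {F G : ℕ → Series} → (∀ i → i < K → F i ≈ G i) → sum₀ K F ≈ sum₀ K G
sum₀-cong zero    F≈G = ≈-refl
sum₀-cong (suc K) F≈G = ⊕-cong (sum₀-cong K (λ i i<K → F≈G i (ℕₚ.m<n⇒m<1+n i<K))) (F≈G K ℕₚ.≤-refl)

sum₀-head : ∀ K (F : ℕ → Series) → sum₀ (suc K) F ≈ F 0 ⊕ sum₀ K (F ∘ suc)
sum₀-head zero    F n = trans (ℤₚ.+-identityˡ (F 0 n)) (sym (ℤₚ.+-identityʳ (F 0 n)))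
sum₀-head (suc K) F n = trans (cong (ℤ._+ F (suc K) n) (sum₀-head K F n)) (ℤₚ.+-assoc (F 0 n) _ _)

sum₀-⊕ : ∀ K (F G : ℕ → Series) → sum₀ K (λ i → F i ⊕ G i) ≈ sum₀ K F ⊕ sum₀ K G
sum₀-⊕ zero    F G n = refl
sum₀-⊕ (suc K) F G n = trans (cong (ℤ._+ (F K n ℤ.+ G K n)) (sum₀-⊕ K F G n))
                             (interchange (sum₀ K F n) (sum₀ K G n) (F K n) (G K n))

⊗-sum₀ : ∀ K c (F : ℕ → Series) → c ⊗ sum₀ K F ≈ sum₀ K (λ i → c ⊗ F i)
⊗-sum₀ zero    c F n = sumℕ-zero (suc n) (λ j _ → ℤₚ.*-zeroʳ (c j))
⊗-sum₀ (suc K) c F   = ≈-trans (⊗-distribˡ-⊕ c (sum₀ K F) (F K)) (⊕-cong (⊗-sum₀ K c F) (≈-refl {c ⊗ F K}))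

sum₀-𝟘 : ∀ K (F : ℕ → Series) → (∀ i → i < K → F i ≈ 𝟘) → sum₀ K F ≈ 𝟘
sum₀-𝟘 zero    F F≈𝟘 = zeroS≈𝟘
sum₀-𝟘 (suc K) F F≈𝟘 = begin
  sum₀ K F ⊕ F K  ≈⟨ ⊕-cong (sum₀-𝟘 K F (λ i i<K → F≈𝟘 i (ℕₚ.m<n⇒m<1+n i<K))) (F≈𝟘 K ℕₚ.≤-refl) ⟩
  𝟘 ⊕ 𝟘           ≈⟨ solve 0 (con 0ℤ :+ con 0ℤ := con 0ℤ) ≈-refl ⟩
  𝟘               ∎

sum₁≈sum₀ : ∀ K (F : ℕ → Series) → sum₁ K F ≈ sum₀ K (F ∘ suc)
sum₁≈sum₀ zero    F = ≈-refl
sum₁≈sum₀ (suc K) F = ⊕-cong (sum₁≈sum₀ K F) (≈-refl {F (suc K)})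

sum₁-cong : ∀ K {F G : ℕ → Series} → (∀ i → 1 ≤ i → i ≤ K → F i ≈ G i) → sum₁ K F ≈ sum₁ K G
sum₁-cong zero    F≈G = ≈-refl
sum₁-cong (suc K) F≈G =
  ⊕-cong (sum₁-cong K (λ i 1≤i i≤K → F≈G i 1≤i (ℕₚ.m≤n⇒m≤1+n i≤K))) (F≈G (suc K) (s≤s z≤n) ℕₚ.≤-refl)

sum₁-⊕ : ∀ K (F G : ℕ → Series) → sum₁ K (λ i → F i ⊕ G i) ≈ sum₁ K F ⊕ sum₁ K G
sum₁-⊕ K F G = begin
  sum₁ K (λ i → F i ⊕ G i)            ≈⟨ sum₁≈sum₀ K _ ⟩
  sum₀ K (λ i → F (suc i) ⊕ G (suc i)) ≈⟨ sum₀-⊕ K (F ∘ suc) (G ∘ suc) ⟩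
  sum₀ K (F ∘ suc) ⊕ sum₀ K (G ∘ suc)  ≈⟨ ⊕-cong (sum₁≈sum₀ K F) (sum₁≈sum₀ K G) ⟨
  sum₁ K F ⊕ sum₁ K G                  ∎

X^-self : ∀ a → X^ a a ≡ 1ℤ
X^-self a rewrite dec-true (a ≟ a) refl = refl

X^-other : ∀ {a n} → a ≢ n → X^ a n ≡ 0ℤ
X^-other {a} {n} a≢n rewrite dec-false (a ≟ n) a≢n = refl

X^-zero : X^ 0 ≈ 𝟙
X^-zero zero    = X^-self 0
X^-zero (suc n) = X^-other {0} {suc n} (λ ())

sumℕ-X^-≥ : ∀ N a (h : ℕ → ℤ) → N ≤ a → sumℕ N (λ j → X^ a j ℤ.* h j) ≡ 0ℤ
sumℕ-X^-≥ N a h N≤a = sumℕ-zero N (λ j j<N →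
  cong (ℤ._* h j) (X^-other (λ a≡j → ℕₚ.<⇒≢ (ℕₚ.<-≤-trans j<N N≤a) (sym a≡j))))

sumℕ-X^-< : ∀ N a (h : ℕ → ℤ) → a < N → sumℕ N (λ j → X^ a j ℤ.* h j) ≡ h a
sumℕ-X^-< (suc N) a h a<1+N with a ≟ N
... | yes refl = trans (cong₂ ℤ._+_ (sumℕ-X^-≥ N a h ℕₚ.≤-refl) (cong (ℤ._* h a) (X^-self a)))
                       (trans (ℤₚ.+-identityˡ _) (ℤₚ.*-identityˡ (h a)))
... | no a≢N   = trans (cong₂ ℤ._+_ (sumℕ-X^-< N a h (ℕₚ.≤∧≢⇒< (ℕₚ.≤-pred a<1+N) a≢N))
                                   (cong (ℤ._* h N) (X^-other a≢N)))
                       (ℤₚ.+-identityʳ (h a))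

X^-⊗-coeff-+ : ∀ a g m → (X^ a ⊗ g) (a + m) ≡ g m
X^-⊗-coeff-+ a g m = trans (sumℕ-X^-< (suc (a + m)) a (λ j → g (a + m ∸ j)) (s≤s (ℕₚ.m≤m+n a m)))
                           (cong g (ℕₚ.m+n∸m≡n a m))

X^-⊗-coeff-< : ∀ a g n → n < a → (X^ a ⊗ g) n ≡ 0ℤ
X^-⊗-coeff-< a g n n<a = sumℕ-X^-≥ (suc n) a (λ j → g (n ∸ j)) n<a

≈-by-split-at : ∀ a {f g} → (∀ n → n < a → f n ≡ g n) → (∀ m → f (a + m) ≡ g (a + m)) → f ≈ g
≈-by-split-at a {f} {g} below above n with n <? a
... | yes n<a = below n n<a
... | no  n≮a = subst (λ i → f i ≡ g i) (ℕₚ.m+[n∸m]≡n (ℕₚ.≮⇒≥ n≮a)) (above (n ∸ a))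

X^-+ : ∀ a b → X^ a ⊗ X^ b ≈ X^ (a + b)
X^-+ a b = ≈-by-split-at a below above
  where
  below : ∀ n → n < a → (X^ a ⊗ X^ b) n ≡ X^ (a + b) n
  below n n<a = trans (X^-⊗-coeff-< a (X^ b) n n<a)
    (sym (X^-other (λ a+b≡n → ℕₚ.<⇒≱ n<a (ℕₚ.≤-trans (ℕₚ.m≤m+n a b) (ℕₚ.≤-reflexive a+b≡n)))))
  above : ∀ m → (X^ a ⊗ X^ b) (a + m) ≡ X^ (a + b) (a + m)
  above m with b ≟ m
  ... | yes refl = trans (X^-⊗-coeff-+ a (X^ b) b) (trans (X^-self b) (sym (X^-self (a + b))))
  ... | no  b≢m  = trans (X^-⊗-coeff-+ a (X^ b) m)
                         (trans (X^-other b≢m) (sym (X^-other (b≢m ∘ ℕₚ.+-cancelˡ-≡ a b m))))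

⊗-X^-+ : ∀ u a b → u ⊗ X^ (a + b) ≈ X^ a ⊗ (u ⊗ X^ b)
⊗-X^-+ u a b = begin
  u ⊗ X^ (a + b)     ≈⟨ ⊗-cong (≈-refl {u}) (X^-+ a b) ⟨
  u ⊗ (X^ a ⊗ X^ b)  ≈⟨ solve 3 (λ u x y → u :* (x :* y) := x :* (u :* y)) ≈-refl u (X^ a) (X^ b) ⟩
  X^ a ⊗ (u ⊗ X^ b)  ∎

X^-exchange : ∀ a b c d u → a + b ≡ c + d → X^ a ⊗ (u ⊗ X^ b) ≈ X^ c ⊗ (u ⊗ X^ d)
X^-exchange a b c d u a+b≡c+d = begin
  X^ a ⊗ (u ⊗ X^ b)  ≈⟨ ⊗-X^-+ u a b ⟨
  u ⊗ X^ (a + b)     ≈⟨ ⊗-cong (≈-refl {u}) (≡⇒≈ (cong X^ a+b≡c+d)) ⟩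
  u ⊗ X^ (c + d)     ≈⟨ ⊗-X^-+ u c d ⟩
  X^ c ⊗ (u ⊗ X^ d)  ∎

oneMinusX^≈ : ∀ i → oneMinusX^ i ≈ 𝟙 ⊖ X^ i
oneMinusX^≈ i n = cong (ℤ._- X^ i n) (oneS≈𝟙 n)

invOneMinusX^suc-periodic : ∀ m k → invOneMinusX^suc m (suc m + k) ≡ invOneMinusX^suc m k
invOneMinusX^suc-periodic m k = cong (λ b → if b then 1ℤ else 0ℤ) (agree (suc m ∣? (suc m + k)) (suc m ∣? k))
  where
  agree : (p : Dec (suc m ∣ suc m + k)) (q : Dec (suc m ∣ k)) → does p ≡ does q
  agree (yes _)    (yes _)  = refl
  agree (no ∤m+k)  (yes ∣k) = contradiction (∣m∣n⇒∣m+n ∣-refl ∣k) ∤m+k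
  agree (yes ∣m+k) (no ∤k)  = contradiction (∣m+n∣m⇒∣n ∣m+k ∣-refl) ∤k
  agree (no _)     (no _)   = refl

invOneMinusX^suc-inverse : ∀ m → invOneMinusX^suc m ⊗ oneMinusX^ (suc m) ≈ 𝟙
invOneMinusX^suc-inverse m = begin
  I ⊗ oneMinusX^ (suc m)  ≈⟨ ⊗-cong (≈-refl {I}) (oneMinusX^≈ (suc m)) ⟩
  I ⊗ (𝟙 ⊖ X^ (suc m))    ≈⟨ solve 2 (λ i x → i :* (con 1ℤ :- x) := i :- x :* i) ≈-refl I (X^ (suc m)) ⟩
  I ⊖ X^ (suc m) ⊗ I      ≈⟨ ≈-by-split-at (suc m) below above ⟩
  𝟙                       ∎
  where
  I : Series
  I = invOneMinusX^suc m
  below : ∀ n → n < suc m → (I ⊖ X^ (suc m) ⊗ I) n ≡ 𝟙 n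
  below n n<1+m = trans (cong (ℤ._-_ (I n)) (X^-⊗-coeff-< (suc m) I n n<1+m))
                        (trans (ℤₚ.+-identityʳ (I n)) (I≡𝟙 n n<1+m))
    where
    I≡𝟙 : ∀ n → n < suc m → I n ≡ 𝟙 n
    I≡𝟙 zero    _     rewrite dec-true (suc m ∣? 0) (suc m ∣0) = refl
    I≡𝟙 (suc n) n<1+m rewrite dec-false (suc m ∣? suc n) (>⇒∤ n<1+m) = refl
  above : ∀ k → (I ⊖ X^ (suc m) ⊗ I) (suc m + k) ≡ 𝟙 (suc m + k)
  above k = trans (cong₂ ℤ._-_ (invOneMinusX^suc-periodic m k) (X^-⊗-coeff-+ (suc m) I k)) (ℤₚ.+-inverseʳ (I k))

oneMinusX^-+ : ∀ a b → 𝟙 ⊖ X^ a ⊗ X^ b ≈ oneMinusX^ (a + b)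
oneMinusX^-+ a b n = trans (cong (ℤ._-_ (𝟙 n)) (X^-+ a b n)) (sym (oneMinusX^≈ (a + b) n))

qFact : ℕ → Series
qFact a = prod₁ a oneMinusX^

invQFact-inverse : ∀ b → invQFact b ⊗ qFact b ≈ 𝟙
invQFact-inverse zero    = ≈-trans (⊗-identityˡ oneS) oneS≈𝟙
invQFact-inverse (suc b) = begin
  (invQFact b ⊗ I) ⊗ (qFact b ⊗ oneMinusX^ (suc b))
    ≈⟨ solve 4 (λ u v w z → (u :* v) :* (w :* z) := (u :* w) :* (v :* z)) ≈-refl
               (invQFact b) I (qFact b) (oneMinusX^ (suc b)) ⟩
  (invQFact b ⊗ qFact b) ⊗ (I ⊗ oneMinusX^ (suc b))
    ≈⟨ ⊗-cong (invQFact-inverse b) (invOneMinusX^suc-inverse b) ⟩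
  𝟙 ⊗ 𝟙
    ≈⟨ solve 0 (con 1ℤ :* con 1ℤ := con 1ℤ) ≈-refl ⟩
  𝟙 ∎
  where
  I : Series
  I = invOneMinusX^suc b

-- Gaussian binomials

qbin : ℕ → ℕ → Series
qbin a       zero    = 𝟙
qbin zero    (suc b) = 𝟘
qbin (suc a) (suc b) = qbin a b ⊕ X^ (suc b) ⊗ qbin a (suc b)

qbin-< : ∀ {a b} → a < b → qbin a b ≈ 𝟘
qbin-< {zero}  {suc b} _         = ≈-refl
qbin-< {suc a} {suc b} (s≤s a<b) = begin
  qbin a b ⊕ X^ (suc b) ⊗ qbin a (suc b)
    ≈⟨ ⊕-cong (qbin-< a<b) (⊗-cong (≈-refl {X^ (suc b)}) (qbin-< (ℕₚ.m<n⇒m<1+n a<b))) ⟩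
  𝟘 ⊕ X^ (suc b) ⊗ 𝟘
    ≈⟨ solve 1 (λ x → con 0ℤ :+ x :* con 0ℤ := con 0ℤ) ≈-refl (X^ (suc b)) ⟩
  𝟘 ∎

qbin-diagonal : ∀ a → qbin a a ≈ 𝟙
qbin-diagonal zero    = ≈-refl
qbin-diagonal (suc a) = begin
  qbin a a ⊕ X^ (suc a) ⊗ qbin a (suc a)
    ≈⟨ ⊕-cong (qbin-diagonal a) (⊗-cong (≈-refl {X^ (suc a)}) (qbin-< {a} ℕₚ.≤-refl)) ⟩
  𝟙 ⊕ X^ (suc a) ⊗ 𝟘
    ≈⟨ solve 1 (λ x → con 1ℤ :+ x :* con 0ℤ := con 1ℤ) ≈-refl (X^ (suc a)) ⟩
  𝟙 ∎

qbin-qFact-step : ∀ b c →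
  qbin (suc (b + c)) b ⊗ qFact b ⊗ qFact (suc c) ≈ qFact (suc (b + c)) →
  qbin (suc (b + c)) (suc b) ⊗ qFact (suc b) ⊗ qFact c ≈ qFact (suc (b + c)) →
  qbin (suc (suc (b + c))) (suc b) ⊗ qFact (suc b) ⊗ qFact (suc c) ≈ qFact (suc (suc (b + c)))
qbin-qFact-step b c IH₁ IH₂ = begin
  (u ⊕ x ⊗ v) ⊗ (p ⊗ s) ⊗ (r ⊗ t)
    ≈⟨ solve 7 (λ u v x p r s t → (u :+ x :* v) :* (p :* s) :* (r :* t)
                                  := s :* (u :* p :* (r :* t)) :+ x :* (v :* (p :* s) :* r) :* t)
               ≈-refl u v x p r s t ⟩
  s ⊗ (u ⊗ p ⊗ (r ⊗ t)) ⊕ x ⊗ (v ⊗ (p ⊗ s) ⊗ r) ⊗ t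
    ≈⟨ ⊕-cong (⊗-cong (oneMinusX^≈ (suc b)) IH₁) (⊗-cong (⊗-cong (≈-refl {x}) IH₂) (oneMinusX^≈ (suc c))) ⟩
  (𝟙 ⊖ x) ⊗ Q ⊕ x ⊗ Q ⊗ (𝟙 ⊖ y)
    ≈⟨ solve 3 (λ Q x y → (con 1ℤ :- x) :* Q :+ x :* Q :* (con 1ℤ :- y) := Q :* (con 1ℤ :- x :* y))
               ≈-refl Q x y ⟩
  Q ⊗ (𝟙 ⊖ x ⊗ y)
    ≈⟨ ⊗-cong (≈-refl {Q}) (oneMinusX^-+ (suc b) (suc c)) ⟩
  Q ⊗ oneMinusX^ (suc b + suc c)
    ≈⟨ ⊗-cong (≈-refl {Q}) (≡⇒≈ (cong (oneMinusX^ ∘ suc) (ℕₚ.+-suc b c))) ⟩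
  Q ⊗ oneMinusX^ (suc (suc (b + c))) ∎
  where
  u v x y p r s t Q : Series
  u = qbin (suc (b + c)) b
  v = qbin (suc (b + c)) (suc b)
  x = X^ (suc b)
  y = X^ (suc c)
  p = qFact b
  r = qFact c
  s = oneMinusX^ (suc b)
  t = oneMinusX^ (suc c)
  Q = qFact (suc (b + c))

qbin-qFact : ∀ b c → qbin (b + c) b ⊗ qFact b ⊗ qFact c ≈ qFact (b + c)
qbin-qFact zero c = begin
  𝟙 ⊗ oneS ⊗ qFact c  ≈⟨ ⊗-cong (⊗-cong (≈-refl {𝟙}) oneS≈𝟙) (≈-refl {qFact c}) ⟩
  𝟙 ⊗ 𝟙 ⊗ qFact c     ≈⟨ solve 1 (λ p → con 1ℤ :* con 1ℤ :* p := p) ≈-refl (qFact c) ⟩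
  qFact c             ∎
qbin-qFact (suc b) zero rewrite ℕₚ.+-identityʳ b = begin
  qbin (suc b) (suc b) ⊗ qFact (suc b) ⊗ oneS
    ≈⟨ ⊗-cong (⊗-cong (qbin-diagonal (suc b)) (≈-refl {qFact (suc b)})) oneS≈𝟙 ⟩
  𝟙 ⊗ qFact (suc b) ⊗ 𝟙
    ≈⟨ solve 1 (λ p → con 1ℤ :* p :* con 1ℤ := p) ≈-refl (qFact (suc b)) ⟩
  qFact (suc b) ∎
qbin-qFact (suc b) (suc c) rewrite ℕₚ.+-suc b c =
  qbin-qFact-step b c
    (subst (λ a → qbin a b ⊗ qFact b ⊗ qFact (suc c) ≈ qFact a) (ℕₚ.+-suc b c) (qbin-qFact b (suc c)))
    (qbin-qFact (suc b) c)

qbin-quotient : ∀ b c → qFact (b + c) ⊗ invQFact b ⊗ invQFact c ≈ qbin (b + c) b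
qbin-quotient b c = begin
  qFact (b + c) ⊗ invQFact b ⊗ invQFact c
    ≈⟨ ⊗-cong (⊗-cong (qbin-qFact b c) (≈-refl {invQFact b})) (≈-refl {invQFact c}) ⟨
  (g ⊗ qFact b ⊗ qFact c) ⊗ invQFact b ⊗ invQFact c
    ≈⟨ solve 5 (λ g p r i j → (g :* p :* r) :* i :* j := g :* (i :* p) :* (j :* r))
               ≈-refl g (qFact b) (qFact c) (invQFact b) (invQFact c) ⟩
  g ⊗ (invQFact b ⊗ qFact b) ⊗ (invQFact c ⊗ qFact c)
    ≈⟨ ⊗-cong (⊗-cong (≈-refl {g}) (invQFact-inverse b)) (invQFact-inverse c) ⟩
  g ⊗ 𝟙 ⊗ 𝟙
    ≈⟨ solve 1 (λ g → g :* con 1ℤ :* con 1ℤ := g) ≈-refl g ⟩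
  g ∎
  where
  g : Series
  g = qbin (b + c) b

qbinom≈qbin : ∀ a b → qbinom a b ≈ qbin a b
qbinom≈qbin a b with b ≤? a
... | yes b≤a rewrite dec-true (b ≤? a) b≤a =
  subst (λ a′ → qFact a′ ⊗ invQFact b ⊗ invQFact (a ∸ b) ≈ qbin a′ b)
        (ℕₚ.m+[n∸m]≡n b≤a) (qbin-quotient b (a ∸ b))
... | no  b≰a rewrite dec-false (b ≤? a) b≰a = ≈-trans zeroS≈𝟘 (≈-sym (qbin-< (ℕₚ.≰⇒> b≰a)))

-- The q-Vandermonde identity

vandermondeTerm : ℕ → ℕ → ℕ → ℕ → Series
vandermondeTerm n m K i = qbin n i ⊗ qbin m (K ∸ i) ⊗ X^ ((K ∸ i) * (n ∸ i))

exponent-shift : ∀ {i k} x → i ≤ k → suc k + (k ∸ i) * x ≡ suc i + (k ∸ i) * suc x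
exponent-shift {i} {k} x i≤k = sym (trans (cong (suc i +_) (ℕₚ.*-suc (k ∸ i) x))
  (cong suc (trans (sym (ℕₚ.+-assoc i (k ∸ i) _)) (cong (_+ (k ∸ i) * x) (ℕₚ.m+[n∸m]≡n i≤k)))))

vandermondeTerm-suc-zero : ∀ n m K →
  vandermondeTerm (suc n) m (suc K) 0 ≈ X^ (suc K) ⊗ vandermondeTerm n m (suc K) 0
vandermondeTerm-suc-zero n m K = begin
  u ⊗ X^ (suc K * suc n)     ≈⟨ ⊗-cong (≈-refl {u}) (≡⇒≈ (cong X^ (ℕₚ.*-suc (suc K) n))) ⟩
  u ⊗ X^ (suc K + suc K * n) ≈⟨ ⊗-X^-+ u (suc K) (suc K * n) ⟩
  X^ (suc K) ⊗ (u ⊗ X^ (suc K * n)) ∎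
  where
  u : Series
  u = 𝟙 ⊗ qbin m (suc K)

vandermondeTerm-suc : ∀ n m K i → i ≤ K →
  vandermondeTerm (suc n) m (suc K) (suc i) ≈ vandermondeTerm n m K i ⊕ X^ (suc K) ⊗ vandermondeTerm n m (suc K) (suc i)
vandermondeTerm-suc n m K i i≤K = begin
  (qbin n i ⊕ X^ (suc i) ⊗ g) ⊗ w ⊗ X^ e
    ≈⟨ solve 5 (λ f x g w y → (f :+ x :* g) :* w :* y := f :* w :* y :+ x :* (g :* w :* y)) ≈-refl
                (qbin n i) (X^ (suc i)) g w (X^ e) ⟩
  qbin n i ⊗ w ⊗ X^ e ⊕ X^ (suc i) ⊗ (g ⊗ w ⊗ X^ e)
    ≈⟨ ⊕-cong (≈-refl {qbin n i ⊗ w ⊗ X^ e}) shifted ⟩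
  qbin n i ⊗ w ⊗ X^ e ⊕ X^ (suc K) ⊗ (g ⊗ w ⊗ X^ e′) ∎
  where
  g w : Series
  g = qbin n (suc i)
  w = qbin m (K ∸ i)
  e e′ : ℕ
  e = (K ∸ i) * (n ∸ i)
  e′ = (K ∸ i) * (n ∸ suc i)
  vanishing : ∀ a d → n ≤ i → X^ a ⊗ (g ⊗ w ⊗ X^ d) ≈ 𝟘
  vanishing a d n≤i = begin
    X^ a ⊗ (g ⊗ w ⊗ X^ d)
      ≈⟨ ⊗-cong (≈-refl {X^ a}) (⊗-cong (⊗-cong (qbin-< (s≤s n≤i)) (≈-refl {w})) (≈-refl {X^ d})) ⟩
    X^ a ⊗ (𝟘 ⊗ w ⊗ X^ d)
      ≈⟨ solve 3 (λ x w y → x :* (con 0ℤ :* w :* y) := con 0ℤ) ≈-refl (X^ a) w (X^ d) ⟩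
    𝟘 ∎
  shifted : X^ (suc i) ⊗ (g ⊗ w ⊗ X^ e) ≈ X^ (suc K) ⊗ (g ⊗ w ⊗ X^ e′)
  -- For n ≤ i the exponents disagree (truncated subtraction), but then qbin n (suc i) vanishes.
  shifted with i <? n
  ... | yes i<n = X^-exchange (suc i) e (suc K) e′ (g ⊗ w)
                    (trans (cong (λ d → suc i + (K ∸ i) * d) (ℕₚ.+-∸-assoc 1 i<n))
                           (sym (exponent-shift (n ∸ suc i) i≤K)))
  ... | no  i≮n = ≈-trans (vanishing (suc i) e (ℕₚ.≮⇒≥ i≮n))
                          (≈-sym (vanishing (suc K) e′ (ℕₚ.≮⇒≥ i≮n)))

vandermonde : ∀ n m K → qbin (n + m) K ≈ sum₀ (suc K) (vandermondeTerm n m K)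
vandermonde zero m K = ≈-sym (begin
  sum₀ (suc K) (vandermondeTerm 0 m K)
    ≈⟨ sum₀-head K (vandermondeTerm 0 m K) ⟩
  𝟙 ⊗ qbin m K ⊗ X^ (K * 0) ⊕ sum₀ K (vandermondeTerm 0 m K ∘ suc)
    ≈⟨ ⊕-cong (⊗-cong (≈-refl {𝟙 ⊗ qbin m K}) (≈-trans (≡⇒≈ (cong X^ (ℕₚ.*-zeroʳ K))) X^-zero))
              (sum₀-𝟘 K _ (λ i _ → solve 2 (λ w y → con 0ℤ :* w :* y := con 0ℤ) ≈-refl
                                         (qbin m (K ∸ suc i)) (X^ ((K ∸ suc i) * 0)))) ⟩
  𝟙 ⊗ qbin m K ⊗ 𝟙 ⊕ 𝟘
    ≈⟨ solve 1 (λ g → con 1ℤ :* g :* con 1ℤ :+ con 0ℤ := g) ≈-refl (qbin m K) ⟩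
  qbin m K ∎)
vandermonde (suc n) m zero = ≈-sym (begin
  zeroS ⊕ 𝟙 ⊗ 𝟙 ⊗ X^ 0  ≈⟨ ⊕-cong zeroS≈𝟘 (⊗-cong (≈-refl {𝟙 ⊗ 𝟙}) X^-zero) ⟩
  𝟘 ⊕ 𝟙 ⊗ 𝟙 ⊗ 𝟙        ≈⟨ solve 0 (con 0ℤ :+ con 1ℤ :* con 1ℤ :* con 1ℤ := con 1ℤ) ≈-refl ⟩
  𝟙                    ∎)
vandermonde (suc n) m (suc K) = begin
  qbin (n + m) K ⊕ x ⊗ qbin (n + m) (suc K)
    ≈⟨ ⊕-cong (vandermonde n m K) (⊗-cong (≈-refl {x}) (vandermonde n m (suc K))) ⟩
  sum₀ (suc K) T ⊕ x ⊗ sum₀ (suc (suc K)) H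
    ≈⟨ ⊕-cong (≈-refl {sum₀ (suc K) T}) (⊗-cong (≈-refl {x}) (sum₀-head (suc K) H)) ⟩
  sum₀ (suc K) T ⊕ x ⊗ (H 0 ⊕ sum₀ (suc K) (H ∘ suc))
    ≈⟨ solve 4 (λ s x h r → s :+ x :* (h :+ r) := x :* h :+ (s :+ x :* r)) ≈-refl
               (sum₀ (suc K) T) x (H 0) (sum₀ (suc K) (H ∘ suc)) ⟩
  x ⊗ H 0 ⊕ (sum₀ (suc K) T ⊕ x ⊗ sum₀ (suc K) (H ∘ suc))
    ≈⟨ ⊕-cong (≈-refl {x ⊗ H 0})
              (≈-trans (sum₀-⊕ (suc K) T (λ i → x ⊗ H (suc i)))
                       (⊕-cong (≈-refl {sum₀ (suc K) T}) (≈-sym (⊗-sum₀ (suc K) x (H ∘ suc))))) ⟨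
  x ⊗ H 0 ⊕ sum₀ (suc K) (λ i → T i ⊕ x ⊗ H (suc i))
    ≈⟨ ⊕-cong (vandermondeTerm-suc-zero n m K)
              (sum₀-cong (suc K) (λ i i<1+K → vandermondeTerm-suc n m K i (ℕₚ.≤-pred i<1+K))) ⟨
  T′ 0 ⊕ sum₀ (suc K) (T′ ∘ suc)
    ≈⟨ sum₀-head (suc K) T′ ⟨
  sum₀ (suc (suc K)) T′ ∎
  where
  x : Series
  x = X^ (suc K)
  T H T′ : ℕ → Series
  T = vandermondeTerm n m K
  H = vandermondeTerm n m (suc K)
  T′ = vandermondeTerm (suc n) m (suc K)

-- Expansion of [k+ℓ, k]

qbin-hockey-stick : ∀ a k → qbin (k + a) k ≈ 𝟙 ⊕ sum₁ k (λ t → X^ t ⊗ qbin (t ∸ 1 + a) t)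
qbin-hockey-stick a zero    n = sym (ℤₚ.+-identityʳ (𝟙 n))
qbin-hockey-stick a (suc k) = begin
  qbin (k + a) k ⊕ x ⊗ qbin (k + a) (suc k)
    ≈⟨ ⊕-cong (qbin-hockey-stick a k) (≈-refl {x ⊗ qbin (k + a) (suc k)}) ⟩
  𝟙 ⊕ sum₁ k F ⊕ x ⊗ qbin (k + a) (suc k)
    ≈⟨ (λ n → ℤₚ.+-assoc (𝟙 n) (sum₁ k F n) _) ⟩
  𝟙 ⊕ sum₁ (suc k) F ∎
  where
  x : Series
  x = X^ (suc k)
  F : ℕ → Series
  F t = X^ t ⊗ qbin (t ∸ 1 + a) t

summand : ℕ → ℕ → ℕ → Series
summand ℓ i j = X^ i ⊗ qbin ℓ i ⊗ (X^ (j * suc (ℓ ∸ i)) ⊗ qbin (i + j ∸ 1) j)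

X^-qbin-expansion : ∀ ℓ s → X^ (suc s) ⊗ qbin (s + ℓ) (suc s) ≈ sum₁ (suc s) (λ i → summand ℓ i (suc s ∸ i))
X^-qbin-expansion ℓ s = begin
  x ⊗ qbin (s + ℓ) (suc s)
    ≈⟨ ⊗-cong (≈-refl {x}) (≡⇒≈ (cong (λ a → qbin a (suc s)) (ℕₚ.+-comm s ℓ))) ⟩
  x ⊗ qbin (ℓ + s) (suc s)
    ≈⟨ ⊗-cong (≈-refl {x}) (vandermonde ℓ s (suc s)) ⟩
  x ⊗ sum₀ (suc (suc s)) H
    ≈⟨ ⊗-cong (≈-refl {x}) (sum₀-head (suc s) H) ⟩
  x ⊗ (H 0 ⊕ sum₀ (suc s) (H ∘ suc))
    ≈⟨ ⊗-cong (≈-refl {x}) (⊕-cong (⊗-cong (⊗-cong (≈-refl {𝟙}) (qbin-< {s} ℕₚ.≤-refl)) (≈-refl {X^ e₀}))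
                                   (≈-refl {sum₀ (suc s) (H ∘ suc)})) ⟩
  x ⊗ (𝟙 ⊗ 𝟘 ⊗ X^ e₀ ⊕ sum₀ (suc s) (H ∘ suc))
    ≈⟨ solve 3 (λ x y r → x :* (con 1ℤ :* con 0ℤ :* y :+ r) := x :* r) ≈-refl
               x (X^ e₀) (sum₀ (suc s) (H ∘ suc)) ⟩
  x ⊗ sum₀ (suc s) (H ∘ suc)
    ≈⟨ ⊗-sum₀ (suc s) x (H ∘ suc) ⟩
  sum₀ (suc s) (λ i → x ⊗ H (suc i))
    ≈⟨ sum₀-cong (suc s) (λ i i<1+s → term i (ℕₚ.≤-pred i<1+s)) ⟩
  sum₀ (suc s) (λ i → summand ℓ (suc i) (s ∸ i))
    ≈⟨ sum₁≈sum₀ (suc s) (λ i → summand ℓ i (suc s ∸ i)) ⟨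
  sum₁ (suc s) (λ i → summand ℓ i (suc s ∸ i)) ∎
  where
  x : Series
  x = X^ (suc s)
  H : ℕ → Series
  H = vandermondeTerm ℓ s (suc s)
  e₀ : ℕ
  e₀ = suc s * ℓ
  term : ∀ i → i ≤ s → x ⊗ H (suc i) ≈ summand ℓ (suc i) (s ∸ i)
  term i i≤s = begin
    x ⊗ (g ⊗ qbin s (s ∸ i) ⊗ X^ ((s ∸ i) * (ℓ ∸ suc i)))
      ≈⟨ X^-exchange (suc s) _ (suc i) _ (g ⊗ qbin s (s ∸ i)) (exponent-shift (ℓ ∸ suc i) i≤s) ⟩
    X^ (suc i) ⊗ (g ⊗ qbin s (s ∸ i) ⊗ y)
      ≈⟨ solve 4 (λ x g w y → x :* (g :* w :* y) := x :* g :* (y :* w)) ≈-refl (X^ (suc i)) g (qbin s (s ∸ i)) y ⟩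
    X^ (suc i) ⊗ g ⊗ (y ⊗ qbin s (s ∸ i))
      ≈⟨ ⊗-cong (≈-refl {X^ (suc i) ⊗ g})
                (⊗-cong (≈-refl {y}) (≡⇒≈ (cong (λ a → qbin a (s ∸ i)) (ℕₚ.m+[n∸m]≡n i≤s)))) ⟨
    X^ (suc i) ⊗ g ⊗ (y ⊗ qbin (i + (s ∸ i)) (s ∸ i)) ∎
    where
    g y : Series
    g = qbin ℓ (suc i)
    y = X^ ((s ∸ i) * suc (ℓ ∸ suc i))

sum₁-antidiagonal : ∀ k (F : ℕ → ℕ → Series) →
  sum₁ k (λ t → sum₁ t (λ i → F i (t ∸ i))) ≈ sum₁ k (λ i → sum₀ (suc (k ∸ i)) (F i))
sum₁-antidiagonal zero    F = ≈-refl
sum₁-antidiagonal (suc k) F = begin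
  sum₁ k (λ t → sum₁ t (λ i → F i (t ∸ i))) ⊕ R
    ≈⟨ ⊕-cong (sum₁-antidiagonal k F) (≈-refl {R}) ⟩
  sum₁ k (λ i → sum₀ (suc (k ∸ i)) (F i)) ⊕ R
    ≈⟨ ⊕-cong reindex (≈-refl {R}) ⟩
  sum₁ (suc k) (λ i → sum₀ (suc k ∸ i) (F i)) ⊕ R
    ≈⟨ sum₁-⊕ (suc k) (λ i → sum₀ (suc k ∸ i) (F i)) (λ i → F i (suc k ∸ i)) ⟨
  sum₁ (suc k) (λ i → sum₀ (suc (suc k ∸ i)) (F i)) ∎
  where
  R : Series
  R = sum₁ (suc k) (λ i → F i (suc k ∸ i))
  reindex : sum₁ k (λ i → sum₀ (suc (k ∸ i)) (F i)) ≈ sum₁ (suc k) (λ i → sum₀ (suc k ∸ i) (F i))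
  reindex = begin
    sum₁ k (λ i → sum₀ (suc (k ∸ i)) (F i))
      ≈⟨ sum₁-cong k (λ i _ i≤k → ≡⇒≈ (cong (λ j → sum₀ j (F i)) (ℕₚ.+-∸-assoc 1 i≤k))) ⟨
    sum₁ k (λ i → sum₀ (suc k ∸ i) (F i))
      ≈⟨ (λ n → sym (ℤₚ.+-identityʳ _)) ⟩
    sum₁ k (λ i → sum₀ (suc k ∸ i) (F i)) ⊕ zeroS
      ≈⟨ ⊕-cong (≈-refl {sum₁ k (λ i → sum₀ (suc k ∸ i) (F i))})
                (≡⇒≈ (cong (λ j → sum₀ j (F (suc k))) (ℕₚ.n∸n≡0 k))) ⟨
    sum₁ (suc k) (λ i → sum₀ (suc k ∸ i) (F i)) ∎

-- The identity holds for all k and ℓ.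
mainTheorem1 : (k ℓ : ℕ) → k ≥ 1 → ℓ ≥ 1 →
    ∀ n → qbinom (k + ℓ) k n
        ≡ (oneS ⊕ sum₁ k (λ i → sum₀ (suc (k ∸ i)) (λ j →
            X^ i ⊗ qbinom ℓ i ⊗ (X^ (j * (suc (ℓ ∸ i))) ⊗ qbinom (i + j ∸ 1) j)))) n
mainTheorem1 k ℓ _ _ = begin
  qbinom (k + ℓ) k
    ≈⟨ qbinom≈qbin (k + ℓ) k ⟩
  qbin (k + ℓ) k
    ≈⟨ qbin-hockey-stick ℓ k ⟩
  𝟙 ⊕ sum₁ k (λ t → X^ t ⊗ qbin (t ∸ 1 + ℓ) t)
    ≈⟨ ⊕-cong (≈-refl {𝟙}) (sum₁-cong k λ { (suc s) _ _ → X^-qbin-expansion ℓ s }) ⟩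
  𝟙 ⊕ sum₁ k (λ t → sum₁ t (λ i → summand ℓ i (t ∸ i)))
    ≈⟨ ⊕-cong (≈-refl {𝟙}) (sum₁-antidiagonal k (summand ℓ)) ⟩
  𝟙 ⊕ sum₁ k (λ i → sum₀ (suc (k ∸ i)) (summand ℓ i))
    ≈⟨ ⊕-cong oneS≈𝟙 (sum₁-cong k (λ i _ _ → sum₀-cong (suc (k ∸ i)) (λ j _ →
         ⊗-cong (⊗-cong (≈-refl {X^ i}) (qbinom≈qbin ℓ i))
                (⊗-cong (≈-refl {X^ (j * suc (ℓ ∸ i))}) (qbinom≈qbin (i + j ∸ 1) j))))) ⟨
  oneS ⊕ sum₁ k (λ i → sum₀ (suc (k ∸ i)) (λ j →
    X^ i ⊗ qbinom ℓ i ⊗ (X^ (j * (suc (ℓ ∸ i))) ⊗ qbinom (i + j ∸ 1) j))) ∎
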